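{- Let $G$ be a graph with a vertex $v$ such that $\deg(v)=\Delta(G)\ge 2$, where $\Delta(G)$ is the maximum degree of $G$. Then there is a subgraph $H$ of $G$ such that $\chi_{la}(H)=\Delta(G)+1$.
   Context: For a graph $G=(V,E)$ without $K_2$ components, a bijection $f:E\to\{1,2,\dots,|E|\}$ induces the weight $w(u)=\sum_{uv\in E} f(uv)$ of each vertex $u$. The bijection $f$ is a local antimagic labeling if $w(u)\neq w(v)$ for every edge $uv$. The local antimagic chromatic number $\chi_{la}(G)$ is the minimum number of distinct weights over all local antimagic labelings of $G$. -}

module Defs where

open import Data.Nat using (ℕ; zero; suc; _≤_; _⊔_)
import Data.Nat as ℕ
open import Data.Fin using (Fin; toℕ; _<_; _≟_)
open import Data.Product using (_×_; _,_; proj₁; proj₂; Σ; ∃)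
open import Data.Sum using (_⊎_)
open import Data.List using (List; length; lookup; map; allFin; filter; foldr; deduplicate)
open import Data.Nat.ListAction using (sum)
open import Data.List.Relation.Unary.All using (All)
open import Data.List.Relation.Unary.Unique.Propositional using (Unique)
open import Data.List.Membership.Propositional using (_∈_)
open import Data.Bool using (Bool; if_then_else_; _∨_)
open import Relation.Nullary using (¬_; does)
open import Relation.Nullary.Decidable using (_⊎-dec_)
open import Relation.Binary.PropositionalEquality using (_≡_; _≢_)
open import Function.Bundles using (_⤖_; Bijection)

-- A finite simple graph on vertex set Fin n: a duplicate-free list of
-- edges {u,v}, each stored once as an ordered pair (u , v) with u < v.
record Graph (n : ℕ) : Set where
  field
    edges   : List (Fin n × Fin n)
    ordered : All (λ e → proj₁ e < proj₂ e) edges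
    unique  : Unique edges
open Graph public

∣E∣ : ∀ {n} → Graph n → ℕ
∣E∣ G = length (edges G)

edge : ∀ {n} (G : Graph n) → Fin (∣E∣ G) → Fin n × Fin n
edge G i = lookup (edges G) i

incident : ∀ {n} → Fin n → Fin n × Fin n → Bool
incident u e = does (u ≟ proj₁ e) ∨ does (u ≟ proj₂ e)

deg : ∀ {n} → Graph n → Fin n → ℕ
deg G u = length (filter (λ e → (u ≟ proj₁ e) ⊎-dec (u ≟ proj₂ e)) (edges G))

Δ : ∀ {n} → Graph n → ℕ
Δ {n} G = foldr _⊔_ 0 (map (deg G) (allFin n))

-- An edge labeling: a bijection f : E → {1,…,|E|}, encoded as a bijection
-- of Fin |E|; edge i receives label toℕ (f i) + 1.
Labeling : ∀ {n} → Graph n → Set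
Labeling G = Fin (∣E∣ G) ⤖ Fin (∣E∣ G)

label : ∀ {n} (G : Graph n) → Labeling G → Fin (∣E∣ G) → ℕ
label G f i = suc (toℕ (Bijection.to f i))

weight : ∀ {n} (G : Graph n) → Labeling G → Fin n → ℕ
weight G f u =
  sum (map (λ i → if incident u (edge G i) then label G f i else 0) (allFin (∣E∣ G)))

IsLocalAntimagic : ∀ {n} (G : Graph n) → Labeling G → Set
IsLocalAntimagic G f =
  ∀ u v → (u , v) ∈ edges G → weight G f u ≢ weight G f v

numWeights : ∀ {n} (G : Graph n) → Labeling G → ℕ
numWeights {n} G f = length (deduplicate Data.Nat._≟_ (map (weight G f) (allFin n)))

NoK2Component : ∀ {n} → Graph n → Set
NoK2Component G = ∀ u v → (u , v) ∈ edges G → ¬ (deg G u ≡ 1 × deg G v ≡ 1)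

LAChromaticNumber : ∀ {n} → Graph n → ℕ → Set
LAChromaticNumber G k =
  Σ (Labeling G) (λ f → IsLocalAntimagic G f × numWeights G f ≡ k)
  × (∀ (f : Labeling G) → IsLocalAntimagic G f → k ≤ numWeights G f)

record Subgraph {m n : ℕ} (H : Graph m) (G : Graph n) : Set where
  field
    ι       : Fin m → Fin n
    ι-inj   : ∀ a b → ι a ≡ ι b → a ≡ b
    ι-edges : ∀ a b → (a , b) ∈ edges H →
              ((ι a , ι b) ∈ edges G) ⊎ ((ι b , ι a) ∈ edges G)

-- Take the star K₁,Δ formed by v and the Δ edges at v. In a star with at least two
-- leaves, under any labeling, the centre's weight is the sum of all labels while a
-- leaf's weight is the label of its single edge: the centre outweighs every leaf, and
-- distinct leaves carry distinct labels. So every labeling is local antimagic with all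
-- Δ + 1 weights distinct, whence χ_la(K₁,Δ) = Δ + 1.
module Submission where

open import Defs
open import Data.Nat using (ℕ; zero; suc; _≤_; _<_; _+_; z≤n; s≤s)
import Data.Nat as ℕ
import Data.Nat.Properties as ℕP
open import Data.Fin using (Fin) renaming (zero to fzero; suc to fsuc; _<_ to _<ᶠ_; _≟_ to _≟ᶠ_)
import Data.Fin.Properties as FP
open import Data.Product using (Σ; ∃; _×_; _,_; proj₁; proj₂)
open import Data.Sum using (_⊎_; inj₁; inj₂)
open import Data.Empty using (⊥; ⊥-elim)
open import Data.Bool using (Bool; true; false; if_then_else_)
open import Data.List using (List; []; _∷_; map; allFin; tabulate; lookup; length; filter; deduplicate)
open import Data.Nat.ListAction using (sum)
import Data.List.Properties as LP
open import Data.List.Relation.Unary.All as All using (All; _∷_)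
import Data.List.Relation.Unary.All.Properties as AllP
import Data.List.Relation.Unary.Any as Any
open import Data.List.Relation.Unary.Any using (here; there)
import Data.List.Relation.Unary.Any.Properties as AnyP
open import Data.List.Relation.Unary.AllPairs using (_∷_)
open import Data.List.Relation.Unary.Unique.Propositional using (Unique)
import Data.List.Relation.Unary.Unique.Propositional.Properties as UniqueP
open import Data.List.Membership.Propositional using (_∈_)
open import Data.List.Membership.Propositional.Properties using (∈-map⁺; ∈-map⁻; ∈-lookup; ∈-allFin; ∈-filter⁻)
open import Relation.Nullary using (Dec; ¬?; does; yes; no)
open import Relation.Nullary.Decidable using (_⊎-dec_; dec-true; dec-false)
open import Relation.Binary.Definitions using (DecidableEquality)
open import Relation.Binary.PropositionalEquality using (_≡_; _≢_; refl; sym; trans; cong; subst; subst₂; module ≡-Reasoning)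
open import Function using (_∘_; id)
open import Function.Definitions using (Injective)
open import Function.Bundles using (Bijection)
open import Function.Construct.Identity using (⤖-id)

open ≡-Reasoning

lookup-injective : ∀ {a} {A : Set a} {xs : List A} → Unique xs →
                   ∀ i j → lookup xs i ≡ lookup xs j → i ≡ j
lookup-injective (_ ∷ _)     fzero    fzero    _  = refl
lookup-injective (x∉ ∷ _)    fzero    (fsuc j) eq = ⊥-elim (All.lookup x∉ (∈-lookup j) eq)
lookup-injective (x∉ ∷ _)    (fsuc i) fzero    eq = ⊥-elim (All.lookup x∉ (∈-lookup i) (sym eq))
lookup-injective (_ ∷ uniq)  (fsuc i) (fsuc j) eq = cong fsuc (lookup-injective uniq i j eq)

deduplicate-unique : ∀ {a} {A : Set a} (_≟_ : DecidableEquality A) {xs : List A} →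
                     Unique xs → deduplicate _≟_ xs ≡ xs
deduplicate-unique _≟_ {[]}     _           = refl
deduplicate-unique _≟_ {x ∷ xs} (x∉ ∷ uniq) rewrite deduplicate-unique _≟_ uniq =
  cong (x ∷_) (LP.filter-all (λ y → ¬? (x ≟ y)) x∉)

length-map-allFin : ∀ {a} {A : Set a} {n} (h : Fin n → A) → length (map h (allFin n)) ≡ n
length-map-allFin {n = n} h = trans (LP.length-map h (allFin n)) (LP.length-tabulate id)

sum-tabulate-zero : ∀ {n} (h : Fin n → ℕ) → (∀ j → h j ≡ 0) → sum (tabulate h) ≡ 0
sum-tabulate-zero {zero}  h _    = refl
sum-tabulate-zero {suc n} h all-zero rewrite all-zero fzero = sum-tabulate-zero (h ∘ fsuc) (all-zero ∘ fsuc)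

sum-tabulate-single : ∀ {n} (h : Fin n → ℕ) i → (∀ j → j ≢ i → h j ≡ 0) → sum (tabulate h) ≡ h i
sum-tabulate-single {suc n} h fzero    vanish
  rewrite sum-tabulate-zero (h ∘ fsuc) (λ j → vanish (fsuc j) λ ()) = ℕP.+-identityʳ (h fzero)
sum-tabulate-single {suc n} h (fsuc i) vanish
  rewrite vanish fzero (λ ()) =
  sum-tabulate-single (h ∘ fsuc) i (λ j j≢i → vanish (fsuc j) (j≢i ∘ FP.suc-injective))

∈⇒≤sum : ∀ {x : ℕ} {xs} → x ∈ xs → x ≤ sum xs
∈⇒≤sum {xs = y ∷ ys} (here refl) = ℕP.m≤m+n y (sum ys)
∈⇒≤sum {xs = y ∷ ys} (there x∈) = ℕP.≤-trans (∈⇒≤sum x∈) (ℕP.m≤n+m (sum ys) y)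

∈⇒<sum : ∀ {x : ℕ} {xs} → x ∈ xs → All (0 <_) xs → 2 ≤ length xs → x < sum xs
∈⇒<sum {xs = _ ∷ []}     (here refl) _              (s≤s ())
∈⇒<sum {xs = y ∷ z ∷ zs} (here refl) (_ ∷ 0<z ∷ _) _ =
  ℕP.m<m+n y (ℕP.<-≤-trans 0<z (ℕP.m≤m+n z (sum zs)))
∈⇒<sum {xs = y ∷ ys}     (there x∈)  (0<y ∷ _)     _ =
  ℕP.<-≤-trans (ℕP.m<n+m _ 0<y) (ℕP.+-monoʳ-≤ y (∈⇒≤sum x∈))

module _ {n} (G : Graph n) where

  edge-ordered : ∀ {u w} → (u , w) ∈ edges G → u <ᶠ w
  edge-ordered = All.lookup (ordered G)

  edge-irreflexive : ∀ {u w} → (u , w) ∈ edges G → u ≢ w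
  edge-irreflexive uw∈ u≡w = FP.<-irrefl u≡w (edge-ordered uw∈)

  edge-asymmetric : ∀ {u w} → (u , w) ∈ edges G → (w , u) ∈ edges G → ⊥
  edge-asymmetric uw∈ wu∈ = FP.<-asym (edge-ordered uw∈) (edge-ordered wu∈)

  module _ (f : Labeling G) where

    labelSum : ℕ
    labelSum = sum (map (label G f) (allFin (∣E∣ G)))

    label-injective : ∀ i j → label G f i ≡ label G f j → i ≡ j
    label-injective i j eq =
      Bijection.injective f (FP.toℕ-injective (ℕP.suc-injective eq))

    label<labelSum : 2 ≤ ∣E∣ G → ∀ i → label G f i < labelSum
    label<labelSum 2≤∣E∣ i =
      ∈⇒<sum (∈-map⁺ (label G f) (∈-allFin i))
             (AllP.map⁺ (All.universal (λ _ → s≤s z≤n) (allFin (∣E∣ G))))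
             (subst (2 ≤_) (sym (length-map-allFin (label G f))) 2≤∣E∣)

    weight-universal : ∀ {u} → (∀ i → incident u (edge G i) ≡ true) → weight G f u ≡ labelSum
    weight-universal at = cong sum (LP.map-cong (λ i → cong (λ b → if b then label G f i else 0) (at i))
                                                (allFin (∣E∣ G)))

    weight-pendant : ∀ {u} i → incident u (edge G i) ≡ true →
                     (∀ j → j ≢ i → incident u (edge G j) ≡ false) → weight G f u ≡ label G f i
    weight-pendant {u} i at-i off-i = begin
      weight G f u     ≡⟨ cong sum (LP.map-tabulate id h) ⟩
      sum (tabulate h) ≡⟨ sum-tabulate-single h i (λ j j≢i → cong (contribution j) (off-i j j≢i)) ⟩
      h i              ≡⟨ cong (contribution i) at-i ⟩
      label G f i      ∎
      where
        contribution : Fin (∣E∣ G) → Bool → ℕ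
        contribution j b = if b then label G f j else 0
        h : Fin (∣E∣ G) → ℕ
        h j = contribution j (incident u (edge G j))

    numWeights-injective : Injective _≡_ _≡_ (weight G f) → numWeights G f ≡ n
    numWeights-injective inj = begin
      length (deduplicate ℕ._≟_ (map (weight G f) (allFin n)))
        ≡⟨ cong length (deduplicate-unique ℕ._≟_ (UniqueP.map⁺ inj (UniqueP.allFin⁺ n))) ⟩
      length (map (weight G f) (allFin n))
        ≡⟨ length-map-allFin (weight G f) ⟩
      n ∎

    injective⇒localAntimagic : Injective _≡_ _≡_ (weight G f) → IsLocalAntimagic G f
    injective⇒localAntimagic inj u w uw∈ = edge-irreflexive uw∈ ∘ inj

  injectiveWeights⇒χla : (∀ f → Injective _≡_ _≡_ (weight G f)) → LAChromaticNumber G n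
  injectiveWeights⇒χla inj =
    (f₀ , injective⇒localAntimagic f₀ (inj f₀) , numWeights-injective f₀ (inj f₀))
    , λ f _ → ℕP.≤-reflexive (sym (numWeights-injective f (inj f)))
    where
      f₀ : Labeling G
      f₀ = ⤖-id _

module Star (k : ℕ) where

  spoke : Fin k → Fin (suc k) × Fin (suc k)
  spoke j = (fzero , fsuc j)

  spoke-injective : Injective _≡_ _≡_ spoke
  spoke-injective = FP.suc-injective ∘ cong proj₂

  star : Graph (suc k)
  star = record
    { edges   = map spoke (allFin k)
    ; ordered = AllP.map⁺ (All.universal (λ _ → s≤s z≤n) (allFin k))
    ; unique  = UniqueP.map⁺ spoke-injective (UniqueP.allFin⁺ k)
    }

  ∈star⇒spoke : ∀ {e} → e ∈ edges star → ∃ λ j → e ≡ spoke j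
  ∈star⇒spoke e∈ with ∈-map⁻ spoke e∈
  ... | j , _ , e≡ = j , e≡

  ∣E∣-star : ∣E∣ star ≡ k
  ∣E∣-star = length-map-allFin spoke

  spokeIndex : Fin k → Fin (∣E∣ star)
  spokeIndex j = Any.index (∈-map⁺ spoke (∈-allFin j))

  edge-spokeIndex : ∀ j → edge star (spokeIndex j) ≡ spoke j
  edge-spokeIndex j = sym (AnyP.lookup-index (∈-map⁺ spoke (∈-allFin j)))

  leaf : Fin (∣E∣ star) → Fin k
  leaf i = proj₁ (∈star⇒spoke (∈-lookup {xs = edges star} i))

  edge-leaf : ∀ i → edge star i ≡ spoke (leaf i)
  edge-leaf i = proj₂ (∈star⇒spoke (∈-lookup {xs = edges star} i))

  spokeIndex-leaf : ∀ i → spokeIndex (leaf i) ≡ i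
  spokeIndex-leaf i =
    lookup-injective (unique star) _ _ (trans (edge-spokeIndex (leaf i)) (sym (edge-leaf i)))

  weight-centre : ∀ f → weight star f fzero ≡ labelSum star f
  weight-centre f = weight-universal star f {fzero} (cong (incident fzero) ∘ edge-leaf)

  weight-leaf : ∀ f j → weight star f (fsuc j) ≡ label star f (spokeIndex j)
  weight-leaf f j = weight-pendant star f {fsuc j} (spokeIndex j) at off
    where
      at : incident (fsuc j) (edge star (spokeIndex j)) ≡ true
      at = trans (cong (incident (fsuc j)) (edge-spokeIndex j)) (dec-true (fsuc j ≟ᶠ fsuc j) refl)
      off : ∀ i → i ≢ spokeIndex j → incident (fsuc j) (edge star i) ≡ false
      off i i≢ = trans (cong (incident (fsuc j)) (edge-leaf i)) (dec-false (fsuc j ≟ᶠ _) λ j≡ →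
        i≢ (trans (sym (spokeIndex-leaf i)) (cong spokeIndex (sym (FP.suc-injective j≡)))))

  deg-centre : deg star fzero ≡ k
  deg-centre = trans (cong length (LP.filter-all (λ e → (fzero ≟ᶠ proj₁ e) ⊎-dec (fzero ≟ᶠ proj₂ e))
                                                (AllP.map⁺ (All.universal (λ _ → inj₁ refl) (allFin k)))))
                     ∣E∣-star

  module _ (2≤k : 2 ≤ k) where

    leaf<centre : ∀ f j → weight star f (fsuc j) < weight star f fzero
    leaf<centre f j = subst₂ _<_ (sym (weight-leaf f j)) (sym (weight-centre f))
      (label<labelSum star f (subst (2 ≤_) (sym ∣E∣-star) 2≤k) (spokeIndex j))

    weight-injective : ∀ f → Injective _≡_ _≡_ (weight star f)
    weight-injective f {fzero}  {fzero}   _  = refl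
    weight-injective f {fzero}  {fsuc j}  eq = ⊥-elim (ℕP.<-irrefl (sym eq) (leaf<centre f j))
    weight-injective f {fsuc j} {fzero}   eq = ⊥-elim (ℕP.<-irrefl eq (leaf<centre f j))
    weight-injective f {fsuc j} {fsuc j′} eq = cong fsuc (spoke-injective (begin
      spoke j                   ≡⟨ sym (edge-spokeIndex j) ⟩
      edge star (spokeIndex j)  ≡⟨ cong (edge star) (label-injective star f _ _ same-label) ⟩
      edge star (spokeIndex j′) ≡⟨ edge-spokeIndex j′ ⟩
      spoke j′                  ∎))
      where
        same-label : label star f (spokeIndex j) ≡ label star f (spokeIndex j′)
        same-label = trans (sym (weight-leaf f j)) (trans eq (weight-leaf f j′))

    χla-star : LAChromaticNumber star (suc k)
    χla-star = injectiveWeights⇒χla star weight-injective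

    star-noK2 : NoK2Component star
    star-noK2 u w uw∈ (deg-u≡1 , _) with ∈star⇒spoke uw∈
    ... | j , refl = ℕP.<-irrefl (trans (sym deg-u≡1) deg-centre) 2≤k

module StarAt {n} (G : Graph n) (v : Fin n) where

  AtV : Fin n × Fin n → Set
  AtV e = (v ≡ proj₁ e) ⊎ (v ≡ proj₂ e)

  AtV? : ∀ e → Dec (AtV e)
  AtV? e = (v ≟ᶠ proj₁ e) ⊎-dec (v ≟ᶠ proj₂ e)

  edgesAt : List (Fin n × Fin n)
  edgesAt = filter AtV? (edges G)

  neighbour : Fin n × Fin n → Fin n
  neighbour e = if does (v ≟ᶠ proj₁ e) then proj₂ e else proj₁ e

  at-v-shape : ∀ e → AtV e → e ≡ (v , neighbour e) ⊎ e ≡ (neighbour e , v)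
  at-v-shape e at with v ≟ᶠ proj₁ e | at
  ... | yes refl | _       = inj₁ refl
  ... | no v≢    | inj₁ v≡ = ⊥-elim (v≢ v≡)
  ... | no _     | inj₂ refl = inj₂ refl

  ι : Fin (suc (length edgesAt)) → Fin n
  ι fzero    = v
  ι (fsuc j) = neighbour (lookup edgesAt j)

  spokeAt∈G×atV : ∀ j → lookup edgesAt j ∈ edges G × AtV (lookup edgesAt j)
  spokeAt∈G×atV j = ∈-filter⁻ AtV? {xs = edges G} (∈-lookup j)

  spokeAt∈G : ∀ j → lookup edgesAt j ∈ edges G
  spokeAt∈G j = proj₁ (spokeAt∈G×atV j)

  spokeAt-shape : ∀ j → lookup edgesAt j ≡ (v , ι (fsuc j)) ⊎ lookup edgesAt j ≡ (ι (fsuc j) , v)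
  spokeAt-shape j = at-v-shape _ (proj₂ (spokeAt∈G×atV j))

  v≢neighbour : ∀ j → v ≢ ι (fsuc j)
  v≢neighbour j with spokeAt-shape j
  ... | inj₁ q = edge-irreflexive G (subst (_∈ edges G) q (spokeAt∈G j))
  ... | inj₂ q = edge-irreflexive G (subst (_∈ edges G) q (spokeAt∈G j)) ∘ sym

  spokes-determined : ∀ j j′ → ι (fsuc j) ≡ ι (fsuc j′) → lookup edgesAt j ≡ lookup edgesAt j′
  spokes-determined j j′ eq with spokeAt-shape j | spokeAt-shape j′
  ... | inj₁ q | inj₁ q′ = trans q (trans (cong (v ,_) eq) (sym q′))
  ... | inj₂ q | inj₂ q′ = trans q (trans (cong (_, v) eq) (sym q′))
  ... | inj₁ q | inj₂ q′ = ⊥-elim (edge-asymmetric G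
    (subst (_∈ edges G) q (spokeAt∈G j)) (subst (_∈ edges G) (trans q′ (cong (_, v) (sym eq))) (spokeAt∈G j′)))
  ... | inj₂ q | inj₁ q′ = ⊥-elim (edge-asymmetric G
    (subst (_∈ edges G) (trans q′ (cong (v ,_) (sym eq))) (spokeAt∈G j′)) (subst (_∈ edges G) q (spokeAt∈G j)))

  ι-injective : ∀ a b → ι a ≡ ι b → a ≡ b
  ι-injective fzero    fzero     _  = refl
  ι-injective fzero    (fsuc j)  eq = ⊥-elim (v≢neighbour j eq)
  ι-injective (fsuc j) fzero     eq = ⊥-elim (v≢neighbour j (sym eq))
  ι-injective (fsuc j) (fsuc j′) eq =
    cong fsuc (lookup-injective (UniqueP.filter⁺ AtV? (unique G)) j j′ (spokes-determined j j′ eq))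

  starAt : Subgraph (Star.star (deg G v)) G
  starAt = record { ι = ι ; ι-inj = ι-injective ; ι-edges = ι-edges }
    where
      ι-edges : ∀ a b → (a , b) ∈ edges (Star.star (deg G v)) →
                ((ι a , ι b) ∈ edges G) ⊎ ((ι b , ι a) ∈ edges G)
      ι-edges a b ab∈ with Star.∈star⇒spoke (deg G v) ab∈
      ... | j , refl with spokeAt-shape j
      ... | inj₁ q = inj₁ (subst (_∈ edges G) q (spokeAt∈G j))
      ... | inj₂ q = inj₂ (subst (_∈ edges G) q (spokeAt∈G j))

mainTheorem15 : ∀ {n : ℕ} (G : Graph n) (v : Fin n) →
    deg G v ≡ Δ G → 2 ≤ Δ G →
    Σ ℕ (λ m → Σ (Graph m) (λ H →
      Subgraph H G × NoK2Component H × LAChromaticNumber H (Δ G + 1)))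
mainTheorem15 G v deg≡Δ 2≤Δ =
  suc (Δ G) , star
  , subst (λ d → Subgraph (Star.star d) G) deg≡Δ (StarAt.starAt G v)
  , star-noK2 2≤Δ
  , subst (LAChromaticNumber star) (ℕP.+-comm 1 (Δ G)) (χla-star 2≤Δ)
  where open Star (Δ G)
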